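{- For $m,n,l\in\mathbb{N}_0$, $$Z_{n}^{(l)}(m)=2^{ -l}\sum_{j=0}^{l}\binom{l}{j}\frac{(-1)^{j(m+1)}}{(n+1)_{l}}\sum_{k=0}^{n+l}\binom{n+l}{k}G_{k}^{(j)}(mj+l)\,G_{n+l-k}^{(l-j)},$$ where $(n)_{0}=1$ and $(n)_{k}=n(n+1)\cdots(n+k-1)$.
   Context: Genocchi polynomials of order $\alpha$: $\Big(\frac{2z}{e^{z}+1}\Big)^{\alpha}e^{xz}=\sum_{n\ge0}G_{n}^{(\alpha)}(x)\frac{z^{n}}{n!}$, and Genocchi numbers of order $\alpha$: $G_n^{(\alpha)}:=G_n^{(\alpha)}(0)$. For $m,k,l\in\mathbb{N}_0$: $$Z_{k}^{(l)}(m)=(-1)^{l}\sum_{\substack{v_1,\dots,v_m\ge 0\\ v_{1}+\dots+v_{m}=l}}\frac{l!}{v_1!\cdots v_m!}(-1)^{v_{1}+2v_{2}+\dots+mv_{m}}(v_{1}+2v_{2}+\dots+mv_{m})^{k},$$ with $0^0=1$. -}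

module Defs where

open import Data.Nat as ℕ using (ℕ; zero; suc)
open import Data.Nat.Properties using (_!≢0; m*n≢0; m^n≢0)
open import Data.Integer as ℤ using (ℤ; +_)
open import Data.Rational as ℚ using (ℚ; 0ℚ; 1ℚ; _+_; _*_; -_; 1/_)
open import Data.Fin using (Fin; toℕ)
open import Data.Vec as Vec using (Vec; []; _∷_)
open import Data.List as List using (List; []; _∷_; _++_)

-- Σ[0..n] f  =  f 0 + f 1 + ... + f n   (inclusive upper bound)
sumTo : ℕ → (ℕ → ℚ) → ℚ
sumTo zero    f = f zero
sumTo (suc n) f = sumTo n f + f (suc n)

sumList : List ℚ → ℚ
sumList = List.foldr _+_ 0ℚ

sumVec : ∀ {n} → Vec ℚ n → ℚ
sumVec = Vec.foldr _ _+_ 0ℚ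

ℕ→ℚ : ℕ → ℚ
ℕ→ℚ n = (+ n) ℚ./ 1

ℤ→ℚ : ℤ → ℚ
ℤ→ℚ z = z ℚ./ 1

_^ℚ_ : ℚ → ℕ → ℚ
x ^ℚ zero  = 1ℚ
x ^ℚ suc n = x * (x ^ℚ n)

inv! : ℕ → ℚ
inv! n = ((+ 1) ℚ./ (n ℕ.!)) {{n !≢0}}

-- Formal power series over ℚ, as coefficient sequences: f = Σ f n z^n

PS : Set
PS = ℕ → ℚ

_⊛_ : PS → PS → PS
(f ⊛ g) n = sumTo n (λ k → f k * g (n ℕ.∸ k))

oneS : PS
oneS zero    = 1ℚ
oneS (suc _) = 0ℚ

_^S_ : PS → ℕ → PS
f ^S zero  = oneS
f ^S suc a = f ⊛ (f ^S a)

scaleS : ℚ → PS → PS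
scaleS c f n = c * f n

-- multiplication by z
zS : PS → PS
zS f zero    = 0ℚ
zS f (suc n) = f n

-- e^{xz} = Σ x^n z^n / n!
expS : ℚ → PS
expS x n = (x ^ℚ n) * inv! n

-- e^z + 1
expPlusOne : PS
expPlusOne zero    = expS 1ℚ zero + 1ℚ
expPlusOne (suc n) = expS 1ℚ (suc n)

-- Multiplicative inverse of a power series with invertible constant term:
--   b 0 = 1 / a 0,   b (n+1) = - (1 / a 0) * Σ_{i=0}^{n} a (i+1) * b (n-i)
module Inverse (a : PS) .{{_ : ℚ.NonZero (a zero)}} where
  c : ℚ
  c = 1/ (a zero)

  -- revPrefix n = [b n, b (n-1), ..., b 0]
  revPrefix : (n : ℕ) → Vec ℚ (suc n)
  revPrefix zero    = c ∷ []
  revPrefix (suc n) = new ∷ prev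
    where
      prev : Vec ℚ (suc n)
      prev = revPrefix n
      new : ℚ
      new = - (c * sumVec (Vec.tabulate (λ (i : Fin (suc n)) → a (suc (toℕ i)) * Vec.lookup prev i)))

  invS : PS
  invS n = Vec.head (revPrefix n)

invS : (a : PS) → .{{ℚ.NonZero (a zero)}} → PS
invS a = Inverse.invS a

-- Genocchi polynomials of (natural) order α:
--   (2z/(e^z+1))^α e^{xz} = Σ G_n^{(α)}(x) z^n / n!

genocchiGF : ℕ → ℚ → PS
genocchiGF α x = ((scaleS (ℕ→ℚ 2) (zS (invS expPlusOne))) ^S α) ⊛ expS x

genocchiPoly : ℕ → ℚ → ℕ → ℚ
genocchiPoly α x n = ℕ→ℚ (n ℕ.!) * genocchiGF α x n

-- G_n^{(α)} = G_n^{(α)}(0)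
genocchiNum : ℕ → ℕ → ℚ
genocchiNum α n = genocchiPoly α 0ℚ n

weakCompositions : (m l : ℕ) → List (Vec ℕ m)
weakCompositions zero    zero    = [] ∷ []
weakCompositions zero    (suc l) = []
weakCompositions (suc m) l =
  List.concatMap (λ v → List.map (v ∷_) (weakCompositions m (l ℕ.∸ v)))
                 (List.upTo (suc l))

factProd : ∀ {m} → Vec ℕ m → ℕ
factProd []       = 1
factProd (v ∷ vs) = v ℕ.! ℕ.* factProd vs

factProd≢0 : ∀ {m} (v : Vec ℕ m) → ℕ.NonZero (factProd v)
factProd≢0 []       = _
factProd≢0 (v ∷ vs) = m*n≢0 (v ℕ.!) (factProd vs) {{v !≢0}} {{factProd≢0 vs}}

multinomial : ∀ {m} → ℕ → Vec ℕ m → ℕ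
multinomial l v = (l ℕ.! ℕ./ factProd v) {{factProd≢0 v}}

weightFrom : ∀ {m} → ℕ → Vec ℕ m → ℕ
weightFrom w []       = 0
weightFrom w (v ∷ vs) = w ℕ.* v ℕ.+ weightFrom (suc w) vs

weight : ∀ {m} → Vec ℕ m → ℕ
weight = weightFrom 1

signℤ : ℕ → ℤ
signℤ zero    = ℤ.1ℤ
signℤ (suc e) = ℤ.- signℤ e

-- Z_k^{(l)}(m)   (ℕ's _^_ has 0^0 = 1)
Z : (k l m : ℕ) → ℤ
Z k l m = signℤ l ℤ.* List.foldr ℤ._+_ ℤ.0ℤ
  (List.map (λ v → + multinomial l v ℤ.* signℤ (weight v) ℤ.* + (weight v ℕ.^ k))
            (weakCompositions m l))

rising : ℕ → ℕ → ℕ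
rising n zero    = 1
rising n (suc k) = n ℕ.* rising (suc n) k

rising≢0 : ∀ n k → ℕ.NonZero (rising (suc n) k)
rising≢0 n zero    = _
rising≢0 n (suc k) = m*n≢0 (suc n) (rising (suc (suc n)) k) {{_}} {{rising≢0 (suc n) k}}

invRisingSuc : ℕ → ℕ → ℚ
invRisingSuc n l = ((+ 1) ℚ./ rising (suc n) l) {{rising≢0 n l}}

invPow2 : ℕ → ℚ
invPow2 l = ((+ 1) ℚ./ (2 ℕ.^ l)) {{m^n≢0 2 l}}

module Submission where

-- We work in the ring of formal power series over ℚ (coefficient sequences
-- ℕ → ℚ, compared pointwise).  Put  R = Σ_{i=1}^{m} (-1)^i e^{iz},
-- K = 2z/(e^z+1)  (so that  Σ_n G_n^{(α)}(x) z^n/n! = K^α e^{xz})  and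
-- E = e^z + (-1)^{m+1} e^{(m+1)z}.
--   Left side.  By the multinomial theorem  R^l / l!  is the sum over the weak
--   compositions v of l of  Π_i ((-1)^i e^{iz})^{v_i} / v_i!,  and reading off
--   the coefficient of z^n gives  Z_n^{(l)}(m) = (-1)^l n! [z^n] R^l.
--   Right side.  The k-sum is  (n+l)! [z^{n+l}] K^l e^{(mj+l)z}  (a product of
--   exponential generating functions); by the binomial theorem the weighted
--   j-sum of the e^{(mj+l)z} is E^l; telescoping gives  E = -(e^z+1) R,  so
--   K^l E^l = (-2z)^l R^l  and  [z^{n+l}] K^l E^l = (-2)^l [z^n] R^l.  Finally
--   2^{-l} (n+l)! 2^l / (n+1)_l = n!.

open import Defs

module Proof where

  open import Data.Nat as ℕ using (ℕ; zero; suc; _∸_; _≤_; z≤n; _!)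
  import Data.Nat.Properties as ℕP
  open import Data.Nat.Properties using (_!≢0; m^n≢0)
  open import Data.Nat.Combinatorics
    using (_C_; nCk+nC[k+1]≡[n+1]C[k+1]; k>n⇒nCk≡0; nCk≡n!/k![n-k]!; k![n∸k]!∣n!)
  open import Data.Nat.Divisibility using (_∣_; ∣-trans; ∣-refl; *-monoʳ-∣)
  import Data.Nat.DivMod as DM
  open import Data.Integer as ℤ using (ℤ)
  import Data.Integer.Properties as ℤP
  open import Data.Rational as Q using (ℚ; 0ℚ; 1ℚ; _+_; _*_; -_; toℚᵘ)
  open import Data.Rational.Properties
  import Data.Rational.Solver as QSolver
  import Data.Integer.Solver as ℤSolver
  import Data.Nat.Solver as ℕSolver
  open import Data.Rational.Unnormalised as U using (mkℚᵘ; *≡*)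
  import Data.Rational.Unnormalised.Properties as UP
  open import Data.Fin using (Fin; toℕ) renaming (zero to fz; suc to fs)
  open import Data.Vec as Vec using (Vec; []; _∷_)
  import Data.Vec.Properties as VP
  open import Data.List as List using (List; []; _∷_; _++_)
  open import Data.List.Relation.Unary.All as All using (All; []; _∷_)
  import Data.List.Relation.Unary.All.Properties as AllP
  open import Relation.Binary.PropositionalEquality
  open ≡-Reasoning

  module QS = QSolver.+-*-Solver
  module ℤS = ℤSolver.+-*-Solver
  module ℕS = ℕSolver.+-*-Solver

  sumTo-cong≤ : ∀ n {f g : ℕ → ℚ} → (∀ k → k ≤ n → f k ≡ g k) → sumTo n f ≡ sumTo n g
  sumTo-cong≤ zero    f≡g = f≡g 0 z≤n
  sumTo-cong≤ (suc n) f≡g =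
    cong₂ _+_ (sumTo-cong≤ n (λ k k≤n → f≡g k (ℕP.m≤n⇒m≤1+n k≤n))) (f≡g (suc n) ℕP.≤-refl)

  sumTo-cong : ∀ n {f g : ℕ → ℚ} → (∀ k → f k ≡ g k) → sumTo n f ≡ sumTo n g
  sumTo-cong n f≡g = sumTo-cong≤ n (λ k _ → f≡g k)

  sumTo-+ : ∀ n (f g : ℕ → ℚ) → sumTo n (λ k → f k + g k) ≡ sumTo n f + sumTo n g
  sumTo-+ zero    f g = refl
  sumTo-+ (suc n) f g =
    trans (cong (_+ (f (suc n) + g (suc n))) (sumTo-+ n f g))
          (solve 4 (λ a b c d → (a :+ b) :+ (c :+ d) := (a :+ c) :+ (b :+ d)) refl
                 (sumTo n f) (sumTo n g) (f (suc n)) (g (suc n)))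
    where open QS

  sumTo-*ˡ : ∀ n c (f : ℕ → ℚ) → c * sumTo n f ≡ sumTo n (λ k → c * f k)
  sumTo-*ˡ zero    c f = refl
  sumTo-*ˡ (suc n) c f =
    trans (*-distribˡ-+ c (sumTo n f) (f (suc n))) (cong (_+ c * f (suc n)) (sumTo-*ˡ n c f))

  sumTo-*ʳ : ∀ n c (f : ℕ → ℚ) → sumTo n f * c ≡ sumTo n (λ k → f k * c)
  sumTo-*ʳ n c f =
    trans (*-comm (sumTo n f) c) (trans (sumTo-*ˡ n c f) (sumTo-cong n (λ k → *-comm c (f k))))

  sumTo-zero : ∀ n → sumTo n (λ _ → 0ℚ) ≡ 0ℚ
  sumTo-zero zero    = refl
  sumTo-zero (suc n) = cong (_+ 0ℚ) (sumTo-zero n)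

  sumTo-shift : ∀ n (f : ℕ → ℚ) → sumTo (suc n) f ≡ f 0 + sumTo n (λ k → f (suc k))
  sumTo-shift zero    f = refl
  sumTo-shift (suc n) f = trans (cong (_+ f (suc (suc n))) (sumTo-shift n f)) (+-assoc (f 0) _ _)

  sumTo-reverse : ∀ n (f : ℕ → ℚ) → sumTo n f ≡ sumTo n (λ k → f (n ∸ k))
  sumTo-reverse zero    f = refl
  sumTo-reverse (suc n) f = sym (begin
    sumTo (suc n) (λ k → f (suc n ∸ k))   ≡⟨ sumTo-shift n (λ k → f (suc n ∸ k)) ⟩
    f (suc n) + sumTo n (λ k → f (n ∸ k)) ≡⟨ cong (f (suc n) +_) (sym (sumTo-reverse n f)) ⟩
    f (suc n) + sumTo n f                 ≡⟨ +-comm (f (suc n)) (sumTo n f) ⟩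
    sumTo n f + f (suc n)                 ∎)

  sumTo-swap : ∀ a b (h : ℕ → ℕ → ℚ) →
               sumTo a (λ k → sumTo b (h k)) ≡ sumTo b (λ j → sumTo a (λ k → h k j))
  sumTo-swap zero    b h = refl
  sumTo-swap (suc a) b h =
    trans (cong (_+ sumTo b (h (suc a))) (sumTo-swap a b h)) (sym (sumTo-+ b _ (h (suc a))))

  sumTo-triangle : ∀ (g : ℕ → ℕ → ℚ) n →
    sumTo n (λ i → sumTo (n ∸ i) (g i)) ≡ sumTo n (λ s → sumTo s (λ i → g i (s ∸ i)))
  sumTo-triangle g zero    = refl
  sumTo-triangle g (suc n) = begin
    sumTo n (λ i → sumTo (suc n ∸ i) (g i)) + sumTo (n ∸ n) (g (suc n))
      ≡⟨ cong₂ _+_ (sumTo-cong≤ n (λ i i≤n → cong (λ t → sumTo t (g i)) (suc∸ i≤n)))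
                   (cong (λ t → sumTo t (g (suc n))) (ℕP.n∸n≡0 n)) ⟩
    sumTo n (λ i → sumTo (n ∸ i) (g i) + g i (suc (n ∸ i))) + g (suc n) 0
      ≡⟨ cong (_+ g (suc n) 0) (sumTo-+ n _ _) ⟩
    (rows n + sumTo n (λ i → g i (suc (n ∸ i)))) + g (suc n) 0
      ≡⟨ +-assoc (rows n) _ _ ⟩
    rows n + (sumTo n (λ i → g i (suc (n ∸ i))) + g (suc n) 0)
      ≡⟨ cong₂ _+_ (sumTo-triangle g n)
                   (cong₂ _+_ (sumTo-cong≤ n (λ i i≤n → cong (g i) (sym (suc∸ i≤n))))
                              (cong (g (suc n)) (sym (ℕP.n∸n≡0 n)))) ⟩
    sumTo n (λ s → sumTo s (λ i → g i (s ∸ i))) + sumTo (suc n) (λ i → g i (suc n ∸ i)) ∎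
    where
    rows : ℕ → ℚ
    rows n = sumTo n (λ i → sumTo (n ∸ i) (g i))
    suc∸ : ∀ {n i} → i ≤ n → suc n ∸ i ≡ suc (n ∸ i)
    suc∸ i≤n = ℕP.+-∸-assoc 1 i≤n

  -- The casts ℕ → ℚ and ℤ → ℚ are ring homomorphisms; equalities between images
  -- of integers are checked on the unnormalised fractions  a / 1.

  toℚᵘ-ℤ→ℚ : ∀ i → toℚᵘ (ℤ→ℚ i) U.≃ mkℚᵘ i 0
  toℚᵘ-ℤ→ℚ i = toℚᵘ-fromℚᵘ (mkℚᵘ i 0)

  ℤ→ℚ-+ : ∀ a b → ℤ→ℚ (a ℤ.+ b) ≡ ℤ→ℚ a + ℤ→ℚ b
  ℤ→ℚ-+ a b = toℚᵘ-injective (UP.≃-trans (toℚᵘ-ℤ→ℚ (a ℤ.+ b))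
    (UP.≃-trans (*≡* (solve 2 (λ a b → (a :+ b) :* one := (a :* one :+ b :* one) :* one) refl a b))
    (UP.≃-trans (UP.+-cong (UP.≃-sym (toℚᵘ-ℤ→ℚ a)) (UP.≃-sym (toℚᵘ-ℤ→ℚ b)))
                (UP.≃-sym (toℚᵘ-homo-+ (ℤ→ℚ a) (ℤ→ℚ b))))))
    where
    open ℤS
    one = con (ℤ.+ 1)

  ℤ→ℚ-* : ∀ a b → ℤ→ℚ (a ℤ.* b) ≡ ℤ→ℚ a * ℤ→ℚ b
  ℤ→ℚ-* a b = toℚᵘ-injective (UP.≃-trans (toℚᵘ-ℤ→ℚ (a ℤ.* b))
    (UP.≃-trans (*≡* refl)
    (UP.≃-trans (UP.*-cong (UP.≃-sym (toℚᵘ-ℤ→ℚ a)) (UP.≃-sym (toℚᵘ-ℤ→ℚ b)))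
                (UP.≃-sym (toℚᵘ-homo-* (ℤ→ℚ a) (ℤ→ℚ b))))))

  ℤ→ℚ-neg : ∀ a → ℤ→ℚ (ℤ.- a) ≡ - ℤ→ℚ a
  ℤ→ℚ-neg a = toℚᵘ-injective (UP.≃-trans (toℚᵘ-ℤ→ℚ (ℤ.- a))
    (UP.≃-trans (*≡* refl)
    (UP.≃-trans (UP.-‿cong (UP.≃-sym (toℚᵘ-ℤ→ℚ a))) (UP.≃-sym (toℚᵘ-homo‿- (ℤ→ℚ a))))))

  ℕ→ℚ-+ : ∀ a b → ℕ→ℚ (a ℕ.+ b) ≡ ℕ→ℚ a + ℕ→ℚ b
  ℕ→ℚ-+ a b = trans (cong ℤ→ℚ (ℤP.pos-+ a b)) (ℤ→ℚ-+ (ℤ.+ a) (ℤ.+ b))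

  ℕ→ℚ-* : ∀ a b → ℕ→ℚ (a ℕ.* b) ≡ ℕ→ℚ a * ℕ→ℚ b
  ℕ→ℚ-* a b = trans (cong ℤ→ℚ (ℤP.pos-* a b)) (ℤ→ℚ-* (ℤ.+ a) (ℤ.+ b))

  ℕ→ℚ-^ : ∀ a n → ℕ→ℚ (a ℕ.^ n) ≡ ℕ→ℚ a ^ℚ n
  ℕ→ℚ-^ a zero    = refl
  ℕ→ℚ-^ a (suc n) = trans (ℕ→ℚ-* a (a ℕ.^ n)) (cong (ℕ→ℚ a *_) (ℕ→ℚ-^ a n))

  d*[i/d]≡i : ∀ i d .{{_ : ℕ.NonZero d}} → ℕ→ℚ d * (i Q./ d) ≡ ℤ→ℚ i
  d*[i/d]≡i i (suc d) = toℚᵘ-injective (UP.≃-trans (toℚᵘ-homo-* (ℕ→ℚ (suc d)) (i Q./ suc d))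
    (UP.≃-trans (UP.*-cong (toℚᵘ-ℤ→ℚ (ℤ.+ suc d)) (toℚᵘ-fromℚᵘ (mkℚᵘ i d)))
    (UP.≃-trans (*≡* (trans (solve 2 (λ x y → (x :* y) :* con (ℤ.+ 1) := y :* x) refl (ℤ.+ suc d) i)
                             (cong (i ℤ.*_) (cong ℤ.+_ (sym (ℕP.*-identityˡ (suc d)))))))
                (UP.≃-sym (toℚᵘ-ℤ→ℚ i)))))
    where open ℤS

  [i/d]*d≡i : ∀ i d .{{_ : ℕ.NonZero d}} → (i Q./ d) * ℕ→ℚ d ≡ ℤ→ℚ i
  [i/d]*d≡i i d = trans (*-comm (i Q./ d) (ℕ→ℚ d)) (d*[i/d]≡i i d)

  *-cancelˡ-ℕ : ∀ d .{{_ : ℕ.NonZero d}} {x y : ℚ} → ℕ→ℚ d * x ≡ ℕ→ℚ d * y → x ≡ y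
  *-cancelˡ-ℕ d {x} {y} dx≡dy = begin
    x                       ≡⟨ sym (*-identityˡ x) ⟩
    1ℚ * x                  ≡⟨ cong (_* x) (sym ([i/d]*d≡i (ℤ.+ 1) d)) ⟩
    (1/d * ℕ→ℚ d) * x       ≡⟨ *-assoc 1/d _ x ⟩
    1/d * (ℕ→ℚ d * x)       ≡⟨ cong (1/d *_) dx≡dy ⟩
    1/d * (ℕ→ℚ d * y)       ≡⟨ sym (*-assoc 1/d _ y) ⟩
    (1/d * ℕ→ℚ d) * y       ≡⟨ cong (_* y) ([i/d]*d≡i (ℤ.+ 1) d) ⟩
    1ℚ * y                  ≡⟨ *-identityˡ y ⟩
    y                       ∎
    where 1/d = ℤ.+ 1 Q./ d

  1/[a*b] : ∀ a b .{{_ : ℕ.NonZero a}} .{{_ : ℕ.NonZero b}} →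
            (ℤ.+ 1 Q./ (a ℕ.* b)) {{ℕP.m*n≢0 a b}} ≡ (ℤ.+ 1 Q./ a) * (ℤ.+ 1 Q./ b)
  1/[a*b] a b = *-cancelˡ-ℕ (a ℕ.* b) {{ℕP.m*n≢0 a b}} (begin
    ℕ→ℚ (a ℕ.* b) * (ℤ.+ 1 Q./ (a ℕ.* b)) {{ℕP.m*n≢0 a b}}
      ≡⟨ d*[i/d]≡i (ℤ.+ 1) (a ℕ.* b) {{ℕP.m*n≢0 a b}} ⟩
    1ℚ
      ≡⟨ sym (cong₂ _*_ (d*[i/d]≡i (ℤ.+ 1) a) (d*[i/d]≡i (ℤ.+ 1) b)) ⟩
    (ℕ→ℚ a * (ℤ.+ 1 Q./ a)) * (ℕ→ℚ b * (ℤ.+ 1 Q./ b))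
      ≡⟨ solve 4 (λ x y u v → (x :* u) :* (y :* v) := (x :* y) :* (u :* v)) refl
               (ℕ→ℚ a) (ℕ→ℚ b) (ℤ.+ 1 Q./ a) (ℤ.+ 1 Q./ b) ⟩
    (ℕ→ℚ a * ℕ→ℚ b) * ((ℤ.+ 1 Q./ a) * (ℤ.+ 1 Q./ b))
      ≡⟨ cong (_* ((ℤ.+ 1 Q./ a) * (ℤ.+ 1 Q./ b))) (sym (ℕ→ℚ-* a b)) ⟩
    ℕ→ℚ (a ℕ.* b) * ((ℤ.+ 1 Q./ a) * (ℤ.+ 1 Q./ b)) ∎)
    where open QS

  sgn : ℕ → ℚ
  sgn e = ℤ→ℚ (signℤ e)

  sgn-suc : ∀ a → sgn (suc a) ≡ - sgn a
  sgn-suc a = ℤ→ℚ-neg (signℤ a)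

  sgn-+ : ∀ a b → sgn (a ℕ.+ b) ≡ sgn a * sgn b
  sgn-+ a b = trans (cong ℤ→ℚ (signℤ-+ a b)) (ℤ→ℚ-* (signℤ a) (signℤ b))
    where
    signℤ-+ : ∀ a b → signℤ (a ℕ.+ b) ≡ signℤ a ℤ.* signℤ b
    signℤ-+ zero    b = sym (ℤP.*-identityˡ (signℤ b))
    signℤ-+ (suc a) b = trans (cong ℤ.-_ (signℤ-+ a b)) (ℤP.neg-distribˡ-* (signℤ a) (signℤ b))

  sgn-* : ∀ w v → sgn (w ℕ.* v) ≡ sgn w ^ℚ v
  sgn-* w zero    = cong sgn (ℕP.*-zeroʳ w)
  sgn-* w (suc v) =
    trans (cong sgn (ℕP.*-suc w v)) (trans (sgn-+ w (w ℕ.* v)) (cong (sgn w *_) (sgn-* w v)))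

  n!*inv!n : ∀ n → ℕ→ℚ (n !) * inv! n ≡ 1ℚ
  n!*inv!n n = d*[i/d]≡i (ℤ.+ 1) (n !) {{n !≢0}}

  C*k!*[n∸k]! : ∀ {n k} → k ≤ n → (n C k) ℕ.* (k ! ℕ.* (n ∸ k) !) ≡ n !
  C*k!*[n∸k]! {n} {k} k≤n = trans (cong (ℕ._* (k ! ℕ.* (n ∸ k) !)) (nCk≡n!/k![n-k]! k≤n))
    (DM.m/n*n≡m {{ℕP.m*n≢0 (k !) ((n ∸ k) !) {{k !≢0}} {{(n ∸ k) !≢0}}}} (k![n∸k]!∣n! k≤n))

  -- 1/(k! (n-k)!) = C(n,k) / n!, the form in which binomial coefficients arise
  -- when exponential generating functions are multiplied.
  inv!*inv! : ∀ {n k} → k ≤ n → inv! k * inv! (n ∸ k) ≡ inv! n * ℕ→ℚ (n C k)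
  inv!*inv! {n} {k} k≤n = *-cancelˡ-ℕ (n !) {{n !≢0}} (begin
    ℕ→ℚ (n !) * (inv! k * inv! (n ∸ k))
      ≡⟨ cong (λ x → ℕ→ℚ x * (inv! k * inv! (n ∸ k))) (sym (C*k!*[n∸k]! k≤n)) ⟩
    ℕ→ℚ (c ℕ.* (k ! ℕ.* (n ∸ k) !)) * (inv! k * inv! (n ∸ k))
      ≡⟨ cong (_* (inv! k * inv! (n ∸ k)))
              (trans (ℕ→ℚ-* c _) (cong (ℕ→ℚ c *_) (ℕ→ℚ-* (k !) ((n ∸ k) !)))) ⟩
    ℕ→ℚ c * (ℕ→ℚ (k !) * ℕ→ℚ ((n ∸ k) !)) * (inv! k * inv! (n ∸ k))
      ≡⟨ solve 5 (λ c a b x y → c :* (a :* b) :* (x :* y) := c :* (a :* x) :* (b :* y)) refl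
               (ℕ→ℚ c) (ℕ→ℚ (k !)) (ℕ→ℚ ((n ∸ k) !)) (inv! k) (inv! (n ∸ k)) ⟩
    ℕ→ℚ c * (ℕ→ℚ (k !) * inv! k) * (ℕ→ℚ ((n ∸ k) !) * inv! (n ∸ k))
      ≡⟨ cong₂ (λ x y → ℕ→ℚ c * x * y) (n!*inv!n k) (n!*inv!n (n ∸ k)) ⟩
    ℕ→ℚ c * 1ℚ * 1ℚ
      ≡⟨ solve 1 (λ c → c :* con 1ℚ :* con 1ℚ := con 1ℚ :* c) refl (ℕ→ℚ c) ⟩
    1ℚ * ℕ→ℚ c
      ≡⟨ cong (_* ℕ→ℚ c) (sym (n!*inv!n n)) ⟩
    ℕ→ℚ (n !) * inv! n * ℕ→ℚ c
      ≡⟨ *-assoc (ℕ→ℚ (n !)) (inv! n) (ℕ→ℚ c) ⟩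
    ℕ→ℚ (n !) * (inv! n * ℕ→ℚ c) ∎)
    where
    c = n C k
    open QS

  rising*! : ∀ n l → rising (suc n) l ℕ.* n ! ≡ (n ℕ.+ l) !
  rising*! n zero    = trans (ℕP.+-identityʳ (n !)) (cong _! (sym (ℕP.+-identityʳ n)))
  rising*! n (suc l) = begin
    suc n ℕ.* rising (suc (suc n)) l ℕ.* n !
      ≡⟨ solve 3 (λ a r f → a :* r :* f := r :* (a :* f)) refl (suc n) (rising (suc (suc n)) l) (n !) ⟩
    rising (suc (suc n)) l ℕ.* (suc n ℕ.* n !)
      ≡⟨ rising*! (suc n) l ⟩
    (suc n ℕ.+ l) !
      ≡⟨ cong _! (sym (ℕP.+-suc n l)) ⟩
    (n ℕ.+ suc l) ! ∎
    where open ℕS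

  _⊕_ : PS → PS → PS
  (f ⊕ g) n = f n + g n

  zeroS : PS
  zeroS _ = 0ℚ

  ΣS : ℕ → (ℕ → PS) → PS
  ΣS n F t = sumTo n (λ j → F j t)

  ⊛-cong : ∀ {f f′ g g′} → f ≗ f′ → g ≗ g′ → (f ⊛ g) ≗ (f′ ⊛ g′)
  ⊛-cong f≗f′ g≗g′ n = sumTo-cong n (λ k → cong₂ _*_ (f≗f′ k) (g≗g′ (n ∸ k)))

  ⊛-congˡ : ∀ {f f′} g → f ≗ f′ → (f ⊛ g) ≗ (f′ ⊛ g)
  ⊛-congˡ g f≗f′ = ⊛-cong {g = g} f≗f′ (λ _ → refl)

  ⊛-congʳ : ∀ f {g g′} → g ≗ g′ → (f ⊛ g) ≗ (f ⊛ g′)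
  ⊛-congʳ f g≗g′ = ⊛-cong {f} (λ _ → refl) g≗g′

  ⊛-comm : ∀ f g → (f ⊛ g) ≗ (g ⊛ f)
  ⊛-comm f g n = trans (sumTo-reverse n _) (sumTo-cong≤ n (λ k k≤n →
    trans (*-comm (f (n ∸ k)) _) (cong (λ t → g t * f (n ∸ k)) (ℕP.m∸[m∸n]≡n k≤n))))

  -- Associativity: both sides are the sum of f i g j h k over i + j + k = n,
  -- grouped along the triangle in two ways.
  ⊛-assoc : ∀ f g h → ((f ⊛ g) ⊛ h) ≗ (f ⊛ (g ⊛ h))
  ⊛-assoc f g h n = begin
    sumTo n (λ s → sumTo s (λ i → f i * g (s ∸ i)) * h (n ∸ s))
      ≡⟨ sumTo-cong n (λ s → sumTo-*ʳ s _ _) ⟩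
    sumTo n (λ s → sumTo s (λ i → f i * g (s ∸ i) * h (n ∸ s)))
      ≡⟨ sumTo-cong≤ n (λ s s≤n → sumTo-cong≤ s (λ i i≤s →
           cong (λ t → f i * g (s ∸ i) * h t) (sym (n∸i∸[s∸i] i≤s s≤n)))) ⟩
    sumTo n (λ s → sumTo s (λ i → term i (s ∸ i)))
      ≡⟨ sym (sumTo-triangle term n) ⟩
    sumTo n (λ i → sumTo (n ∸ i) (term i))
      ≡⟨ sumTo-cong n (λ i → trans (sumTo-cong (n ∸ i) (λ j → *-assoc (f i) _ _))
                                   (sym (sumTo-*ˡ (n ∸ i) (f i) _))) ⟩
    sumTo n (λ i → f i * (g ⊛ h) (n ∸ i)) ∎
    where
    term : ℕ → ℕ → ℚ
    term i j = f i * g j * h (n ∸ i ∸ j)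
    n∸i∸[s∸i] : ∀ {i s n} → i ≤ s → s ≤ n → n ∸ i ∸ (s ∸ i) ≡ n ∸ s
    n∸i∸[s∸i] {i} {s} {n} i≤s s≤n =
      trans (ℕP.∸-+-assoc n i (s ∸ i)) (cong (n ∸_) (ℕP.m+[n∸m]≡n i≤s))

  ⊛-distribʳ : ∀ f g h → ((f ⊕ g) ⊛ h) ≗ ((f ⊛ h) ⊕ (g ⊛ h))
  ⊛-distribʳ f g h n =
    trans (sumTo-cong n (λ k → *-distribʳ-+ (h (n ∸ k)) (f k) (g k))) (sumTo-+ n _ _)

  ⊛-distribˡ : ∀ f g h → (h ⊛ (f ⊕ g)) ≗ ((h ⊛ f) ⊕ (h ⊛ g))
  ⊛-distribˡ f g h n =
    trans (sumTo-cong n (λ k → *-distribˡ-+ (h k) (f (n ∸ k)) (g (n ∸ k)))) (sumTo-+ n _ _)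

  scale-⊛ˡ : ∀ c f g → (scaleS c f ⊛ g) ≗ scaleS c (f ⊛ g)
  scale-⊛ˡ c f g n = trans (sumTo-cong n (λ k → *-assoc c (f k) _)) (sym (sumTo-*ˡ n c _))

  scale-⊛ʳ : ∀ c f g → (f ⊛ scaleS c g) ≗ scaleS c (f ⊛ g)
  scale-⊛ʳ c f g n =
    trans (⊛-comm f (scaleS c g) n) (trans (scale-⊛ˡ c g f n) (cong (c *_) (⊛-comm g f n)))

  oneS-⊛ : ∀ f → (oneS ⊛ f) ≗ f
  oneS-⊛ f zero    = *-identityˡ (f 0)
  oneS-⊛ f (suc n) = begin
    sumTo (suc n) (λ k → oneS k * f (suc n ∸ k))
      ≡⟨ sumTo-shift n (λ k → oneS k * f (suc n ∸ k)) ⟩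
    1ℚ * f (suc n) + sumTo n (λ k → 0ℚ * f (n ∸ k))
      ≡⟨ cong₂ _+_ (*-identityˡ (f (suc n)))
                   (trans (sumTo-cong n (λ k → *-zeroˡ (f (n ∸ k)))) (sumTo-zero n)) ⟩
    f (suc n) + 0ℚ
      ≡⟨ +-identityʳ _ ⟩
    f (suc n) ∎

  ⊛-oneS : ∀ f → (f ⊛ oneS) ≗ f
  ⊛-oneS f n = trans (⊛-comm f oneS n) (oneS-⊛ f n)

  zeroS-⊛ : ∀ f → (zeroS ⊛ f) ≗ zeroS
  zeroS-⊛ f n = trans (sumTo-cong n (λ k → *-zeroˡ (f (n ∸ k)))) (sumTo-zero n)

  ⊛-zeroS : ∀ f → (f ⊛ zeroS) ≗ zeroS
  ⊛-zeroS f n = trans (⊛-comm f zeroS n) (zeroS-⊛ f n)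

  ⊛-leftComm : ∀ a b c → (a ⊛ (b ⊛ c)) ≗ (b ⊛ (a ⊛ c))
  ⊛-leftComm a b c n = begin
    (a ⊛ (b ⊛ c)) n ≡⟨ sym (⊛-assoc a b c n) ⟩
    ((a ⊛ b) ⊛ c) n ≡⟨ ⊛-congˡ c (⊛-comm a b) n ⟩
    ((b ⊛ a) ⊛ c) n ≡⟨ ⊛-assoc b a c n ⟩
    (b ⊛ (a ⊛ c)) n ∎

  ⊛-interchange : ∀ a b c d → ((a ⊛ b) ⊛ (c ⊛ d)) ≗ ((a ⊛ c) ⊛ (b ⊛ d))
  ⊛-interchange a b c d n = begin
    ((a ⊛ b) ⊛ (c ⊛ d)) n ≡⟨ ⊛-assoc a b (c ⊛ d) n ⟩
    (a ⊛ (b ⊛ (c ⊛ d))) n ≡⟨ ⊛-congʳ a (⊛-leftComm b c d) n ⟩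
    (a ⊛ (c ⊛ (b ⊛ d))) n ≡⟨ sym (⊛-assoc a c (b ⊛ d) n) ⟩
    ((a ⊛ c) ⊛ (b ⊛ d)) n ∎

  ΣS-⊛ : ∀ n F g → (ΣS n F ⊛ g) ≗ ΣS n (λ j → F j ⊛ g)
  ΣS-⊛ n F g t = begin
    sumTo t (λ k → sumTo n (λ j → F j k) * g (t ∸ k))   ≡⟨ sumTo-cong t (λ k → sumTo-*ʳ n _ _) ⟩
    sumTo t (λ k → sumTo n (λ j → F j k * g (t ∸ k)))   ≡⟨ sumTo-swap t n _ ⟩
    sumTo n (λ j → sumTo t (λ k → F j k * g (t ∸ k)))   ∎

  ⊛-ΣS : ∀ n F g → (g ⊛ ΣS n F) ≗ ΣS n (λ j → g ⊛ F j)
  ⊛-ΣS n F g t = trans (⊛-comm g (ΣS n F) t)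
    (trans (ΣS-⊛ n F g t) (sumTo-cong n (λ j → ⊛-comm (F j) g t)))

  ^S-cong : ∀ {f g} l → f ≗ g → (f ^S l) ≗ (g ^S l)
  ^S-cong zero    f≗g n = refl
  ^S-cong (suc l) f≗g   = ⊛-cong f≗g (^S-cong l f≗g)

  ^S-+ : ∀ f a b → (f ^S (a ℕ.+ b)) ≗ ((f ^S a) ⊛ (f ^S b))
  ^S-+ f zero    b t = sym (oneS-⊛ (f ^S b) t)
  ^S-+ f (suc a) b t = trans (⊛-congʳ f (^S-+ f a b) t) (sym (⊛-assoc f (f ^S a) (f ^S b) t))

  ⊛-^S : ∀ f g l → ((f ⊛ g) ^S l) ≗ ((f ^S l) ⊛ (g ^S l))
  ⊛-^S f g zero    n = sym (oneS-⊛ oneS n)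
  ⊛-^S f g (suc l) n =
    trans (⊛-congʳ (f ⊛ g) (⊛-^S f g l) n) (⊛-interchange f g (f ^S l) (g ^S l) n)

  scale-^S : ∀ c f l → (scaleS c f ^S l) ≗ scaleS (c ^ℚ l) (f ^S l)
  scale-^S c f zero    n = sym (*-identityˡ _)
  scale-^S c f (suc l) n = begin
    (scaleS c f ⊛ (scaleS c f ^S l)) n
      ≡⟨ ⊛-congʳ (scaleS c f) (scale-^S c f l) n ⟩
    (scaleS c f ⊛ scaleS (c ^ℚ l) (f ^S l)) n
      ≡⟨ scale-⊛ˡ c f (scaleS (c ^ℚ l) (f ^S l)) n ⟩
    c * (f ⊛ scaleS (c ^ℚ l) (f ^S l)) n
      ≡⟨ cong (c *_) (scale-⊛ʳ (c ^ℚ l) f (f ^S l) n) ⟩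
    c * (c ^ℚ l * (f ⊛ (f ^S l)) n)
      ≡⟨ sym (*-assoc c _ _) ⟩
    c * c ^ℚ l * (f ⊛ (f ^S l)) n ∎

  oneS-^S : ∀ l → (oneS ^S l) ≗ oneS
  oneS-^S zero    t = refl
  oneS-^S (suc l) t = trans (⊛-congʳ oneS (oneS-^S l) t) (oneS-⊛ oneS t)

  zeroS-^S : ∀ l → (zeroS ^S suc l) ≗ zeroS
  zeroS-^S l = zeroS-⊛ (zeroS ^S l)

  zSⁿ : ℕ → PS → PS
  zSⁿ zero    h = h
  zSⁿ (suc l) h = zS (zSⁿ l h)

  zSⁿ-coeff : ∀ l h n → zSⁿ l h (l ℕ.+ n) ≡ h n
  zSⁿ-coeff zero    h n = refl
  zSⁿ-coeff (suc l) h n = zSⁿ-coeff l h n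

  zSⁿ-cong : ∀ l {f g} → f ≗ g → zSⁿ l f ≗ zSⁿ l g
  zSⁿ-cong zero    f≗g         = f≗g
  zSⁿ-cong (suc l) f≗g zero    = refl
  zSⁿ-cong (suc l) f≗g (suc n) = zSⁿ-cong l f≗g n

  zS-⊛ : ∀ f g → (zS f ⊛ g) ≗ zS (f ⊛ g)
  zS-⊛ f g zero    = *-zeroˡ (g 0)
  zS-⊛ f g (suc n) = trans (sumTo-shift n (λ k → zS f k * g (suc n ∸ k)))
    (trans (cong (_+ (f ⊛ g) n) (*-zeroˡ (g (suc n)))) (+-identityˡ _))

  zSⁿ-⊛ : ∀ l f g → (zSⁿ l f ⊛ g) ≗ zSⁿ l (f ⊛ g)
  zSⁿ-⊛ zero    f g n = refl
  zSⁿ-⊛ (suc l) f g zero    = zS-⊛ (zSⁿ l f) g zero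
  zSⁿ-⊛ (suc l) f g (suc n) = trans (zS-⊛ (zSⁿ l f) g (suc n)) (zSⁿ-⊛ l f g n)

  zS-^S : ∀ f l → (zS f ^S l) ≗ zSⁿ l (f ^S l)
  zS-^S f zero    n = refl
  zS-^S f (suc l) n = begin
    (zS f ⊛ (zS f ^S l)) n        ≡⟨ ⊛-congʳ (zS f) (zS-^S f l) n ⟩
    (zS f ⊛ zSⁿ l (f ^S l)) n     ≡⟨ zS-⊛ f (zSⁿ l (f ^S l)) n ⟩
    zS (f ⊛ zSⁿ l (f ^S l)) n     ≡⟨ zS-cong (λ t → trans (⊛-comm f (zSⁿ l (f ^S l)) t)
                                       (trans (zSⁿ-⊛ l (f ^S l) f t) (zSⁿ-cong l (⊛-comm (f ^S l) f) t))) n ⟩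
    zS (zSⁿ l (f ⊛ (f ^S l))) n   ∎
    where
    zS-cong : ∀ {f g} → f ≗ g → zS f ≗ zS g
    zS-cong f≗g zero    = refl
    zS-cong f≗g (suc n) = f≗g n

  binomialTerm : PS → PS → ℕ → ℕ → PS
  binomialTerm f g l j = scaleS (ℕ→ℚ (l C j)) ((f ^S j) ⊛ (g ^S (l ∸ j)))

  pascal-sum : ∀ l (y : ℕ → ℚ) →
    sumTo l (λ j → ℕ→ℚ (l C j) * y (suc j)) + sumTo l (λ j → ℕ→ℚ (l C j) * y j)
      ≡ sumTo (suc l) (λ j → ℕ→ℚ (suc l C j) * y j)
  pascal-sum l y = begin
    A + sumTo l (λ j → c l j * y j)
      ≡⟨ cong (A +_) (sym (trans (cong (sumTo l (λ j → c l j * y j) +_) lastTermZero)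
                                 (+-identityʳ _))) ⟩
    A + sumTo (suc l) (λ j → c l j * y j)
      ≡⟨ cong (A +_) (sumTo-shift l (λ j → c l j * y j)) ⟩
    A + (y0 + R)
      ≡⟨ solve 3 (λ a b r → a :+ (b :+ r) := b :+ (r :+ a)) refl A y0 R ⟩
    y0 + (R + A)
      ≡⟨ cong (y0 +_) (sym (trans (sumTo-cong l (λ j → trans
             (cong (λ x → ℕ→ℚ x * y (suc j)) (sym (nCk+nC[k+1]≡[n+1]C[k+1] l j)))
             (trans (cong (_* y (suc j)) (ℕ→ℚ-+ (l C j) (l C suc j)))
                    (*-distribʳ-+ (y (suc j)) (c l j) (c l (suc j))))))
           (trans (sumTo-+ l _ _) (+-comm A R)))) ⟩
    y0 + sumTo l (λ j → c (suc l) (suc j) * y (suc j))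
      ≡⟨ sym (sumTo-shift l (λ j → c (suc l) j * y j)) ⟩
    sumTo (suc l) (λ j → c (suc l) j * y j) ∎
    where
    open QS
    c : ℕ → ℕ → ℚ
    c l j = ℕ→ℚ (l C j)
    A  = sumTo l (λ j → c l j * y (suc j))
    R  = sumTo l (λ j → c l (suc j) * y (suc j))
    y0 = 1ℚ * y 0
    lastTermZero : c l (suc l) * y (suc l) ≡ 0ℚ
    lastTermZero = trans (cong (λ x → ℕ→ℚ x * y (suc l)) (k>n⇒nCk≡0 (ℕP.≤-refl {suc l})))
                         (*-zeroˡ (y (suc l)))

  binomial : ∀ f g l → ((f ⊕ g) ^S l) ≗ ΣS l (binomialTerm f g l)
  binomial f g zero    t = sym (trans (*-identityˡ ((oneS ⊛ oneS) t)) (oneS-⊛ oneS t))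
  binomial f g (suc l) t = begin
    ((f ⊕ g) ⊛ ((f ⊕ g) ^S l)) t
      ≡⟨ ⊛-congʳ (f ⊕ g) (binomial f g l) t ⟩
    ((f ⊕ g) ⊛ ΣS l F) t
      ≡⟨ ⊛-distribʳ f g (ΣS l F) t ⟩
    (f ⊛ ΣS l F) t + (g ⊛ ΣS l F) t
      ≡⟨ cong₂ _+_ (trans (⊛-ΣS l F f t) (sumTo-cong l (λ j →
                      trans (scale-⊛ʳ (c j) f (term j) t)
                            (cong (c j *_) (sym (⊛-assoc f (f ^S j) (g ^S (l ∸ j)) t))))))
                   (trans (⊛-ΣS l F g t) (sumTo-cong≤ l (λ j j≤l →
                      trans (scale-⊛ʳ (c j) g (term j) t) (cong (c j *_) (raise-g j j≤l))))) ⟩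
    sumTo l (λ j → c j * y (suc j)) + sumTo l (λ j → c j * y j)
      ≡⟨ pascal-sum l y ⟩
    ΣS (suc l) (binomialTerm f g (suc l)) t ∎
    where
    F = binomialTerm f g l
    c : ℕ → ℚ
    c j = ℕ→ℚ (l C j)
    y : ℕ → ℚ
    y j = ((f ^S j) ⊛ (g ^S (suc l ∸ j))) t
    term : ℕ → PS
    term j = (f ^S j) ⊛ (g ^S (l ∸ j))
    raise-g : ∀ j → j ≤ l → (g ⊛ term j) t ≡ y j
    raise-g j j≤l = trans (⊛-leftComm g (f ^S j) (g ^S (l ∸ j)) t)
      (cong (λ e → ((f ^S j) ⊛ (g ^S e)) t) (sym (ℕP.+-∸-assoc 1 j≤l)))

  -- The binomial theorem in ℚ, read off the constant term of the series version.
  binomialℚ : ∀ a b n →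
              (a + b) ^ℚ n ≡ sumTo n (λ j → ℕ→ℚ (n C j) * ((a ^ℚ j) * (b ^ℚ (n ∸ j))))
  binomialℚ a b n = begin
    (a + b) ^ℚ n
      ≡⟨ sym (const-^S (a + b) n) ⟩
    (const (a + b) ^S n) 0
      ≡⟨ ^S-cong n (λ t → *-distribʳ-+ (oneS t) a b) 0 ⟩
    ((const a ⊕ const b) ^S n) 0
      ≡⟨ binomial (const a) (const b) n 0 ⟩
    sumTo n (λ j → ℕ→ℚ (n C j) * ((const a ^S j) 0 * (const b ^S (n ∸ j)) 0))
      ≡⟨ sumTo-cong n (λ j → cong (ℕ→ℚ (n C j) *_)
                                   (cong₂ _*_ (const-^S a j) (const-^S b (n ∸ j)))) ⟩
    sumTo n (λ j → ℕ→ℚ (n C j) * ((a ^ℚ j) * (b ^ℚ (n ∸ j)))) ∎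
    where
    const : ℚ → PS
    const c = scaleS c oneS
    const-^S : ∀ c n → (const c ^S n) 0 ≡ c ^ℚ n
    const-^S c n = trans (scale-^S c oneS n 0) (trans (cong (c ^ℚ n *_) (oneS-^S n 0)) (*-identityʳ _))

  -- e^{az} e^{bz} = e^{(a+b)z}: after multiplying by n!, both sides are (a+b)^n.
  expS-⊛ : ∀ a b → (expS a ⊛ expS b) ≗ expS (a + b)
  expS-⊛ a b n = *-cancelˡ-ℕ (n !) {{n !≢0}} (begin
    N * sumTo n (λ k → (a ^ℚ k * inv! k) * (b ^ℚ (n ∸ k) * inv! (n ∸ k)))
      ≡⟨ sumTo-*ˡ n N _ ⟩
    sumTo n (λ k → N * ((a ^ℚ k * inv! k) * (b ^ℚ (n ∸ k) * inv! (n ∸ k))))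
      ≡⟨ sumTo-cong≤ n (λ k k≤n → trans
           (solve 5 (λ N x y u v → N :* ((x :* u) :* (y :* v)) := N :* (u :* v) :* (x :* y)) refl
                  N (a ^ℚ k) (b ^ℚ (n ∸ k)) (inv! k) (inv! (n ∸ k)))
           (cong (_* ((a ^ℚ k) * (b ^ℚ (n ∸ k)))) (n!*inv!*inv! k≤n))) ⟩
    sumTo n (λ j → ℕ→ℚ (n C j) * ((a ^ℚ j) * (b ^ℚ (n ∸ j))))
      ≡⟨ sym (binomialℚ a b n) ⟩
    (a + b) ^ℚ n
      ≡⟨ sym (trans (solve 3 (λ N p i → N :* (p :* i) := (N :* i) :* p) refl N P (inv! n))
                    (trans (cong (_* P) (n!*inv!n n)) (*-identityˡ P))) ⟩
    N * (P * inv! n) ∎)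
    where
    open QS
    N = ℕ→ℚ (n !)
    P = (a + b) ^ℚ n
    n!*inv!*inv! : ∀ {k} → k ≤ n → N * (inv! k * inv! (n ∸ k)) ≡ ℕ→ℚ (n C k)
    n!*inv!*inv! {k} k≤n = trans (cong (N *_) (inv!*inv! k≤n))
      (trans (sym (*-assoc N (inv! n) Cnk)) (trans (cong (_* Cnk) (n!*inv!n n)) (*-identityˡ Cnk)))
      where Cnk = ℕ→ℚ (n C k)

  expS-zero : expS 0ℚ ≗ oneS
  expS-zero zero    = refl
  expS-zero (suc n) = trans (cong (_* inv! (suc n)) (*-zeroˡ (0ℚ ^ℚ n))) (*-zeroˡ (inv! (suc n)))

  expN : ℕ → PS
  expN w = expS (ℕ→ℚ w)

  expN-⊛ : ∀ a b → (expN a ⊛ expN b) ≗ expN (a ℕ.+ b)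
  expN-⊛ a b t = trans (expS-⊛ (ℕ→ℚ a) (ℕ→ℚ b) t) (cong (λ x → expS x t) (sym (ℕ→ℚ-+ a b)))

  expN-^S : ∀ a j → (expN a ^S j) ≗ expN (a ℕ.* j)
  expN-^S a zero    t = trans (sym (expS-zero t)) (cong (λ x → expN x t) (sym (ℕP.*-zeroʳ a)))
  expN-^S a (suc j) t = begin
    (expN a ⊛ (expN a ^S j)) t ≡⟨ ⊛-congʳ (expN a) (expN-^S a j) t ⟩
    (expN a ⊛ expN (a ℕ.* j)) t ≡⟨ expN-⊛ a (a ℕ.* j) t ⟩
    expN (a ℕ.+ a ℕ.* j) t     ≡⟨ cong (λ x → expN x t) (sym (ℕP.*-suc a j)) ⟩
    expN (a ℕ.* suc j) t       ∎

  cexp : ℚ → ℕ → PS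
  cexp c w = scaleS c (expN w)

  cexp-⊛ : ∀ c a d b → (cexp c a ⊛ cexp d b) ≗ cexp (c * d) (a ℕ.+ b)
  cexp-⊛ c a d b t = begin
    (cexp c a ⊛ cexp d b) t        ≡⟨ scale-⊛ˡ c (expN a) (cexp d b) t ⟩
    c * (expN a ⊛ cexp d b) t      ≡⟨ cong (c *_) (scale-⊛ʳ d (expN a) (expN b) t) ⟩
    c * (d * (expN a ⊛ expN b) t)  ≡⟨ sym (*-assoc c d _) ⟩
    c * d * (expN a ⊛ expN b) t    ≡⟨ cong (c * d *_) (expN-⊛ a b t) ⟩
    cexp (c * d) (a ℕ.+ b) t       ∎

  cexp-^S : ∀ c a j → (cexp c a ^S j) ≗ cexp (c ^ℚ j) (a ℕ.* j)
  cexp-^S c a j t = trans (scale-^S c (expN a) j t) (cong (c ^ℚ j *_) (expN-^S a j t))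

  sumVec-tabulate : ∀ n (g : ℕ → ℚ) → sumVec (Vec.tabulate {n = suc n} (λ i → g (toℕ i))) ≡ sumTo n g
  sumVec-tabulate zero    g = +-identityʳ (g 0)
  sumVec-tabulate (suc n) g =
    trans (cong (g 0 +_) (sumVec-tabulate n (λ k → g (suc k)))) (sym (sumTo-shift n g))

  module _ (a : PS) .{{_ : Q.NonZero (a zero)}} where
    open Inverse a using (revPrefix; c)

    lookup-revPrefix : ∀ n (i : Fin (suc n)) → Vec.lookup (revPrefix n) i ≡ invS a (n ∸ toℕ i)
    lookup-revPrefix zero    fz     = refl
    lookup-revPrefix (suc n) fz     = refl
    lookup-revPrefix (suc n) (fs i) = lookup-revPrefix n i

    invS-suc : ∀ n → invS a (suc n) ≡ - (c * sumTo n (λ k → a (suc k) * invS a (n ∸ k)))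
    invS-suc n = cong (λ x → - (c * x))
      (trans (cong sumVec (VP.tabulate-cong (λ i → cong (a (suc (toℕ i)) *_) (lookup-revPrefix n i))))
             (sumVec-tabulate n (λ k → a (suc k) * invS a (n ∸ k))))

    ⊛-invS : (a ⊛ invS a) ≗ oneS
    ⊛-invS zero    = *-inverseʳ (a zero)
    ⊛-invS (suc n) = begin
      sumTo (suc n) (λ k → a k * invS a (suc n ∸ k))
        ≡⟨ sumTo-shift n (λ k → a k * invS a (suc n ∸ k)) ⟩
      a 0 * invS a (suc n) + S
        ≡⟨ cong (λ x → a 0 * x + S) (invS-suc n) ⟩
      a 0 * (- (c * S)) + S
        ≡⟨ cong (_+ S) (trans (sym (neg-distribʳ-* (a 0) (c * S)))
             (cong -_ (trans (sym (*-assoc (a 0) c S))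
                             (trans (cong (_* S) (*-inverseʳ (a zero))) (*-identityˡ S))))) ⟩
      - S + S
        ≡⟨ +-inverseˡ S ⟩
      0ℚ ∎
      where S = sumTo n (λ k → a (suc k) * invS a (n ∸ k))

  ΣL : ∀ {A : Set} → List A → (A → PS) → PS
  ΣL []       F = zeroS
  ΣL (x ∷ xs) F = F x ⊕ ΣL xs F

  ΣL-++ : ∀ {A : Set} (xs ys : List A) F → ΣL (xs ++ ys) F ≗ (ΣL xs F ⊕ ΣL ys F)
  ΣL-++ []       ys F t = sym (+-identityˡ _)
  ΣL-++ (x ∷ xs) ys F t = trans (cong (F x t +_) (ΣL-++ xs ys F t)) (sym (+-assoc (F x t) _ _))

  ΣL-map : ∀ {A B : Set} (f : A → B) (xs : List A) F → ΣL (List.map f xs) F ≗ ΣL xs (λ x → F (f x))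
  ΣL-map f []       F t = refl
  ΣL-map f (x ∷ xs) F t = cong (F (f x) t +_) (ΣL-map f xs F t)

  ΣL-concat : ∀ {A : Set} (xss : List (List A)) F → ΣL (List.concat xss) F ≗ ΣL xss (λ xs → ΣL xs F)
  ΣL-concat []         F t = refl
  ΣL-concat (xs ∷ xss) F t = trans (ΣL-++ xs (List.concat xss) F t) (cong (ΣL xs F t +_) (ΣL-concat xss F t))

  ΣL-applyUpTo : ∀ (g : ℕ → ℕ) l F → ΣL (List.applyUpTo g (suc l)) F ≗ ΣS l (λ k → F (g k))
  ΣL-applyUpTo g zero    F t = +-identityʳ _
  ΣL-applyUpTo g (suc l) F t = trans (cong (F (g 0) t +_) (ΣL-applyUpTo (λ k → g (suc k)) l F t))
                                     (sym (sumTo-shift l (λ k → F (g k) t)))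

  ΣL-cong : ∀ {A : Set} (xs : List A) {F G} → (∀ x → F x ≗ G x) → ΣL xs F ≗ ΣL xs G
  ΣL-cong []       F≗G t = refl
  ΣL-cong (x ∷ xs) F≗G t = cong₂ _+_ (F≗G x t) (ΣL-cong xs F≗G t)

  ⊛-ΣL : ∀ {A : Set} (xs : List A) F h → (h ⊛ ΣL xs F) ≗ ΣL xs (λ x → h ⊛ F x)
  ⊛-ΣL []       F h t = ⊛-zeroS h t
  ⊛-ΣL (x ∷ xs) F h t = trans (⊛-distribˡ (F x) (ΣL xs F) h t) (cong ((h ⊛ F x) t +_) (⊛-ΣL xs F h t))

  ΣL-coeff : ∀ {A : Set} (xs : List A) F t → ΣL xs F t ≡ sumList (List.map (λ x → F x t) xs)
  ΣL-coeff []       F t = refl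
  ΣL-coeff (x ∷ xs) F t = cong (F x t +_) (ΣL-coeff xs F t)

  sumList-map-congAll : ∀ {A : Set} {f g : A → ℚ} {xs} → All (λ x → f x ≡ g x) xs →
                        sumList (List.map f xs) ≡ sumList (List.map g xs)
  sumList-map-congAll []       = refl
  sumList-map-congAll (e ∷ es) = cong₂ _+_ e (sumList-map-congAll es)

  sumList-map-*ˡ : ∀ {A : Set} c (f : A → ℚ) xs →
                   c * sumList (List.map f xs) ≡ sumList (List.map (λ x → c * f x) xs)
  sumList-map-*ˡ c f []       = *-zeroʳ c
  sumList-map-*ˡ c f (x ∷ xs) = trans (*-distribˡ-+ c (f x) _) (cong (c * f x +_) (sumList-map-*ˡ c f xs))

  ℤ→ℚ-sum : ∀ {A : Set} (h : A → ℤ) xs →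
            ℤ→ℚ (List.foldr ℤ._+_ ℤ.0ℤ (List.map h xs)) ≡ sumList (List.map (λ x → ℤ→ℚ (h x)) xs)
  ℤ→ℚ-sum h []       = refl
  ℤ→ℚ-sum h (x ∷ xs) = trans (ℤ→ℚ-+ (h x) _) (cong (ℤ→ℚ (h x) +_) (ℤ→ℚ-sum h xs))

  signedExp : ℕ → PS
  signedExp w = cexp (sgn w) w

  altExpSum : ℕ → ℕ → PS
  altExpSum w zero    = zeroS
  altExpSum w (suc m) = signedExp w ⊕ altExpSum (suc w) m

  invFactProd : ∀ {m} → Vec ℕ m → ℚ
  invFactProd v = ((ℤ.+ 1) Q./ factProd v) {{factProd≢0 v}}

  -- The term of the multinomial expansion of  (altExpSum w m)^l / l!  belonging to
  -- (v₁,…,v_m):  Π_i ((-1)^{w+i-1} e^{(w+i-1)z})^{v_i} / v_i!  =  (-1)^W e^{Wz} / Π_i v_i!,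
  -- where  W = weightFrom w v = w v₁ + (w+1) v₂ + ⋯.
  compositionTerm : ∀ {m} → ℕ → Vec ℕ m → PS
  compositionTerm w v = cexp (invFactProd v * sgn (weightFrom w v)) (weightFrom w v)

  compositionTerm-∷ : ∀ {m} w v₀ (vs : Vec ℕ m) →
    compositionTerm w (v₀ ∷ vs) ≗ (scaleS (inv! v₀) (signedExp w ^S v₀) ⊛ compositionTerm (suc w) vs)
  compositionTerm-∷ w v₀ vs t = sym (begin
    (scaleS (inv! v₀) (signedExp w ^S v₀) ⊛ compositionTerm (suc w) vs) t
      ≡⟨ scale-⊛ˡ (inv! v₀) (signedExp w ^S v₀) (compositionTerm (suc w) vs) t ⟩
    inv! v₀ * ((signedExp w ^S v₀) ⊛ compositionTerm (suc w) vs) t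
      ≡⟨ cong (inv! v₀ *_) (trans (⊛-congˡ (compositionTerm (suc w) vs) (cexp-^S (sgn w) w v₀) t)
                                  (cexp-⊛ (sgn w ^ℚ v₀) (w ℕ.* v₀) (invFactProd vs * sgn W) W t)) ⟩
    inv! v₀ * ((sgn w ^ℚ v₀ * (invFactProd vs * sgn W)) * expN (w ℕ.* v₀ ℕ.+ W) t)
      ≡⟨ sym (*-assoc (inv! v₀) _ _) ⟩
    (inv! v₀ * (sgn w ^ℚ v₀ * (invFactProd vs * sgn W))) * expN (w ℕ.* v₀ ℕ.+ W) t
      ≡⟨ cong (_* expN (w ℕ.* v₀ ℕ.+ W) t) coefficient ⟩
    compositionTerm w (v₀ ∷ vs) t ∎)
    where
    W = weightFrom (suc w) vs
    coefficient : inv! v₀ * (sgn w ^ℚ v₀ * (invFactProd vs * sgn W))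
                  ≡ invFactProd (v₀ ∷ vs) * sgn (w ℕ.* v₀ ℕ.+ W)
    coefficient = begin
      inv! v₀ * (sgn w ^ℚ v₀ * (invFactProd vs * sgn W))
        ≡⟨ solve 4 (λ a s f b → a :* (s :* (f :* b)) := (a :* f) :* (s :* b)) refl
                 (inv! v₀) (sgn w ^ℚ v₀) (invFactProd vs) (sgn W) ⟩
      (inv! v₀ * invFactProd vs) * (sgn w ^ℚ v₀ * sgn W)
        ≡⟨ cong₂ _*_ (sym (1/[a*b] (v₀ !) (factProd vs) {{v₀ !≢0}} {{factProd≢0 vs}}))
                     (trans (cong (_* sgn W) (sym (sgn-* w v₀))) (sym (sgn-+ (w ℕ.* v₀) W))) ⟩
      invFactProd (v₀ ∷ vs) * sgn (w ℕ.* v₀ ℕ.+ W) ∎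
      where open QS

  -- Σ_{v ∈ WC(m,l)} compositionTerm w v  =  (altExpSum w m)^l / l!,
  -- where WC(m,l) = weakCompositions m l: split off the first part v₀ of v,
  -- expand the rest by induction and recombine with the binomial theorem.
  multinomial-expansion : ∀ m w l →
    ΣL (weakCompositions m l) (compositionTerm w) ≗ scaleS (inv! l) (altExpSum w m ^S l)
  multinomial-expansion zero w zero t =
    trans (+-identityʳ _) (cong (1ℚ *_) (expS-zero t))
  multinomial-expansion zero w (suc l) t =
    sym (trans (cong (inv! (suc l) *_) (zeroS-^S l t)) (*-zeroʳ (inv! (suc l))))
  multinomial-expansion (suc m) w l t = begin
    ΣL (List.concat (List.map withHead (List.upTo (suc l)))) (compositionTerm w) t
      ≡⟨ ΣL-concat (List.map withHead (List.upTo (suc l))) (compositionTerm w) t ⟩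
    ΣL (List.map withHead (List.upTo (suc l))) (λ vs → ΣL vs (compositionTerm w)) t
      ≡⟨ ΣL-map withHead (List.upTo (suc l)) (λ vs → ΣL vs (compositionTerm w)) t ⟩
    ΣL (List.upTo (suc l)) (λ v₀ → ΣL (withHead v₀) (compositionTerm w)) t
      ≡⟨ ΣL-applyUpTo (λ v₀ → v₀) l (λ v₀ → ΣL (withHead v₀) (compositionTerm w)) t ⟩
    sumTo l (λ v₀ → ΣL (withHead v₀) (compositionTerm w) t)
      ≡⟨ sumTo-cong≤ l headSum ⟩
    sumTo l (λ v₀ → inv! l * binomialTerm (signedExp w) rest l v₀ t)
      ≡⟨ sym (sumTo-*ˡ l (inv! l) (λ v₀ → binomialTerm (signedExp w) rest l v₀ t)) ⟩
    inv! l * ΣS l (binomialTerm (signedExp w) rest l) t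
      ≡⟨ cong (inv! l *_) (sym (binomial (signedExp w) rest l t)) ⟩
    inv! l * (altExpSum w (suc m) ^S l) t ∎
    where
    withHead : ℕ → List (Vec ℕ (suc m))
    withHead v₀ = List.map (v₀ ∷_) (weakCompositions m (l ∸ v₀))
    rest = altExpSum (suc w) m
    first : ℕ → PS
    first v₀ = scaleS (inv! v₀) (signedExp w ^S v₀)
    headSum : ∀ v₀ → v₀ ≤ l → ΣL (withHead v₀) (compositionTerm w) t
                               ≡ inv! l * binomialTerm (signedExp w) rest l v₀ t
    headSum v₀ v₀≤l = begin
      ΣL (withHead v₀) (compositionTerm w) t
        ≡⟨ ΣL-map (v₀ ∷_) tails (compositionTerm w) t ⟩
      ΣL tails (λ vs → compositionTerm w (v₀ ∷ vs)) t
        ≡⟨ ΣL-cong tails (λ vs → compositionTerm-∷ w v₀ vs) t ⟩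
      ΣL tails (λ vs → first v₀ ⊛ compositionTerm (suc w) vs) t
        ≡⟨ sym (⊛-ΣL tails (compositionTerm (suc w)) (first v₀) t) ⟩
      (first v₀ ⊛ ΣL tails (compositionTerm (suc w))) t
        ≡⟨ ⊛-congʳ (first v₀) (multinomial-expansion m (suc w) (l ∸ v₀)) t ⟩
      (first v₀ ⊛ scaleS (inv! (l ∸ v₀)) (rest ^S (l ∸ v₀))) t
        ≡⟨ trans (scale-⊛ˡ (inv! v₀) (signedExp w ^S v₀) (scaleS (inv! (l ∸ v₀)) restPower) t)
                 (cong (inv! v₀ *_) (scale-⊛ʳ (inv! (l ∸ v₀)) (signedExp w ^S v₀) restPower t)) ⟩
      inv! v₀ * (inv! (l ∸ v₀) * P)
        ≡⟨ sym (*-assoc (inv! v₀) _ P) ⟩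
      inv! v₀ * inv! (l ∸ v₀) * P
        ≡⟨ cong (_* P) (inv!*inv! v₀≤l) ⟩
      inv! l * ℕ→ℚ (l C v₀) * P
        ≡⟨ *-assoc (inv! l) _ P ⟩
      inv! l * binomialTerm (signedExp w) rest l v₀ t ∎
      where
      tails = weakCompositions m (l ∸ v₀)
      restPower = rest ^S (l ∸ v₀)
      P = ((signedExp w ^S v₀) ⊛ restPower) t

  factProd∣l! : ∀ m l → All (λ v → factProd v ∣ l !) (weakCompositions m l)
  factProd∣l! zero    zero    = ∣-refl ∷ []
  factProd∣l! zero    (suc l) = []
  factProd∣l! (suc m) l = AllP.concat⁺ (AllP.map⁺ (AllP.applyUpTo⁺₁ (λ v₀ → v₀) (suc l)
    (λ {v₀} v₀<1+l → AllP.map⁺ (All.map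
      (λ {vs} vs∣ → ∣-trans (*-monoʳ-∣ (v₀ !) vs∣) (k![n∸k]!∣n! (ℕP.≤-pred v₀<1+l)))
      (factProd∣l! m (l ∸ v₀))))))

  multinomial-ℚ : ∀ {m} l (v : Vec ℕ m) → factProd v ∣ l ! →
                  ℕ→ℚ (multinomial l v) ≡ ℕ→ℚ (l !) * invFactProd v
  multinomial-ℚ l v v∣l! = begin
    ℕ→ℚ M                        ≡⟨ sym (*-identityʳ _) ⟩
    ℕ→ℚ M * 1ℚ                   ≡⟨ cong (ℕ→ℚ M *_) (sym (d*[i/d]≡i (ℤ.+ 1) P {{factProd≢0 v}})) ⟩
    ℕ→ℚ M * (ℕ→ℚ P * 1/P)        ≡⟨ sym (*-assoc (ℕ→ℚ M) _ _) ⟩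
    ℕ→ℚ M * ℕ→ℚ P * 1/P          ≡⟨ cong (_* 1/P) (sym (ℕ→ℚ-* M P)) ⟩
    ℕ→ℚ (M ℕ.* P) * 1/P          ≡⟨ cong (λ x → ℕ→ℚ x * 1/P) (DM.m/n*n≡m {{factProd≢0 v}} v∣l!) ⟩
    ℕ→ℚ (l !) * 1/P              ∎
    where
    M = multinomial l v
    P = factProd v
    1/P = invFactProd v

  -- Left side of the corollary:  Z_n^{(l)}(m) = (-1)^l n! [z^n] R^l  with
  -- R = altExpSum 1 m;  the multinomial coefficients and the factor 1/l! cancel.
  Z-as-coefficient : ∀ n l m → ℤ→ℚ (Z n l m) ≡ ℕ→ℚ (n !) * (sgn l * (altExpSum 1 m ^S l) n)
  Z-as-coefficient n l m = begin
    ℤ→ℚ (Z n l m)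
      ≡⟨ ℤ→ℚ-* (signℤ l) _ ⟩
    sgn l * ℤ→ℚ (List.foldr ℤ._+_ ℤ.0ℤ (List.map h WC))
      ≡⟨ cong (sgn l *_) (ℤ→ℚ-sum h WC) ⟩
    sgn l * sumList (List.map (λ v → ℤ→ℚ (h v)) WC)
      ≡⟨ cong (sgn l *_) (sumList-map-congAll (All.map (λ {v} → term v) (factProd∣l! m l))) ⟩
    sgn l * sumList (List.map (λ v → K * compositionTerm 1 v n) WC)
      ≡⟨ cong (sgn l *_) (sym (trans (cong (K *_) (ΣL-coeff WC (compositionTerm 1) n))
                                     (sumList-map-*ˡ K (λ v → compositionTerm 1 v n) WC))) ⟩
    sgn l * (K * ΣL WC (compositionTerm 1) n)
      ≡⟨ cong (λ x → sgn l * (K * x)) (multinomial-expansion m 1 l n) ⟩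
    sgn l * (K * (inv! l * Y))
      ≡⟨ solve 5 (λ s a b c y → s :* ((a :* b) :* (c :* y)) := b :* (s :* y) :* (a :* c)) refl
               (sgn l) (ℕ→ℚ (l !)) (ℕ→ℚ (n !)) (inv! l) Y ⟩
    ℕ→ℚ (n !) * (sgn l * Y) * (ℕ→ℚ (l !) * inv! l)
      ≡⟨ trans (cong (ℕ→ℚ (n !) * (sgn l * Y) *_) (n!*inv!n l)) (*-identityʳ _) ⟩
    ℕ→ℚ (n !) * (sgn l * Y) ∎
    where
    open QS
    WC = weakCompositions m l
    K  = ℕ→ℚ (l !) * ℕ→ℚ (n !)
    Y  = (altExpSum 1 m ^S l) n
    h : Vec ℕ m → ℤ
    h v = ℤ.+ multinomial l v ℤ.* signℤ (weight v) ℤ.* ℤ.+ (weight v ℕ.^ n)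
    term : ∀ v → factProd v ∣ l ! → ℤ→ℚ (h v) ≡ K * compositionTerm 1 v n
    term v v∣l! = begin
      ℤ→ℚ (h v)
        ≡⟨ trans (ℤ→ℚ-* (ℤ.+ multinomial l v ℤ.* signℤ W) _)
                 (cong (_* ℕ→ℚ (W ℕ.^ n)) (ℤ→ℚ-* (ℤ.+ multinomial l v) (signℤ W))) ⟩
      ℕ→ℚ (multinomial l v) * sgn W * ℕ→ℚ (W ℕ.^ n)
        ≡⟨ cong₂ (λ x y → x * sgn W * y) (multinomial-ℚ l v v∣l!) (ℕ→ℚ-^ W n) ⟩
      ℕ→ℚ (l !) * invFactProd v * sgn W * (ℕ→ℚ W ^ℚ n)
        ≡⟨ sym (trans (cong (ℕ→ℚ (l !) * invFactProd v * sgn W * (ℕ→ℚ W ^ℚ n) *_) (n!*inv!n n))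
                      (*-identityʳ _)) ⟩
      ℕ→ℚ (l !) * invFactProd v * sgn W * (ℕ→ℚ W ^ℚ n) * (ℕ→ℚ (n !) * inv! n)
        ≡⟨ solve 6 (λ a b c d e f → a :* b :* c :* d :* (e :* f) := (a :* e) :* ((b :* c) :* (d :* f))) refl
                 (ℕ→ℚ (l !)) (invFactProd v) (sgn W) (ℕ→ℚ W ^ℚ n) (ℕ→ℚ (n !)) (inv! n) ⟩
      K * compositionTerm 1 v n ∎
      where W = weight v

  expPlusOne≗ : expPlusOne ≗ (expN 1 ⊕ oneS)
  expPlusOne≗ zero    = refl
  expPlusOne≗ (suc n) = sym (+-identityʳ _)

  expPlusOne-⊛-expN : ∀ w → (expPlusOne ⊛ expN w) ≗ (expN (suc w) ⊕ expN w)
  expPlusOne-⊛-expN w t = begin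
    (expPlusOne ⊛ expN w) t                ≡⟨ ⊛-congˡ (expN w) expPlusOne≗ t ⟩
    ((expN 1 ⊕ oneS) ⊛ expN w) t           ≡⟨ ⊛-distribʳ (expN 1) oneS (expN w) t ⟩
    (expN 1 ⊛ expN w) t + (oneS ⊛ expN w) t ≡⟨ cong₂ _+_ (expN-⊛ 1 w t) (oneS-⊛ (expN w) t) ⟩
    expN (suc w) t + expN w t              ∎

  telescope : ∀ w m → (expPlusOne ⊛ altExpSum w m) ≗ (signedExp w ⊕ cexp (sgn (suc (w ℕ.+ m))) (w ℕ.+ m))
  telescope w zero t = begin
    (expPlusOne ⊛ zeroS) t                  ≡⟨ ⊛-zeroS expPlusOne t ⟩
    0ℚ                                      ≡⟨ sym (+-inverseʳ (sgn w * e)) ⟩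
    sgn w * e + - (sgn w * e)               ≡⟨ cong (sgn w * e +_) (trans (neg-distribˡ-* (sgn w) e)
                                                                        (cong (_* e) (sym (sgn-suc w)))) ⟩
    sgn w * e + sgn (suc w) * e             ≡⟨ cong (λ x → sgn w * e + cexp (sgn (suc x)) x t)
                                                    (sym (ℕP.+-identityʳ w)) ⟩
    signedExp w t + cexp (sgn (suc (w ℕ.+ 0))) (w ℕ.+ 0) t ∎
    where e = expN w t
  telescope w (suc m) t = begin
    (expPlusOne ⊛ (signedExp w ⊕ altExpSum (suc w) m)) t
      ≡⟨ ⊛-distribˡ (signedExp w) (altExpSum (suc w) m) expPlusOne t ⟩
    (expPlusOne ⊛ signedExp w) t + (expPlusOne ⊛ altExpSum (suc w) m) t
      ≡⟨ cong₂ _+_ (trans (scale-⊛ʳ (sgn w) expPlusOne (expN w) t) (cong (sgn w *_) (expPlusOne-⊛-expN w t)))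
                   (telescope (suc w) m t) ⟩
    sgn w * (a + b) + (sgn (suc w) * a + L)
      ≡⟨ cong (λ x → sgn w * (a + b) + (x * a + L)) (sgn-suc w) ⟩
    sgn w * (a + b) + (- sgn w * a + L)
      ≡⟨ solve 4 (λ s a b L → s :* (a :+ b) :+ ((:- s) :* a :+ L) := s :* b :+ L) refl (sgn w) a b L ⟩
    sgn w * b + L
      ≡⟨ cong (λ x → sgn w * b + cexp (sgn (suc x)) x t) (sym (ℕP.+-suc w m)) ⟩
    signedExp w t + cexp (sgn (suc (w ℕ.+ suc m))) (w ℕ.+ suc m) t ∎
    where
    open QS
    a = expN (suc w) t
    b = expN w t
    L = cexp (sgn (suc (suc w ℕ.+ m))) (suc w ℕ.+ m) t

  -- The series  e^z + (-1)^{m+1} e^{(m+1)z}  whose l-th power collects the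
  -- exponentials on the right-hand side of the corollary.
  expPair : ℕ → PS
  expPair m = cexp (sgn (suc m)) (suc m) ⊕ expN 1

  expPair-^S : ∀ m l →
    (expPair m ^S l) ≗ ΣS l (λ j → cexp (ℕ→ℚ (l C j) * sgn (j ℕ.* (m ℕ.+ 1))) (m ℕ.* j ℕ.+ l))
  expPair-^S m l t = trans (binomial F (expN 1) l t) (sumTo-cong≤ l term)
    where
    F = cexp (sgn (suc m)) (suc m)
    exponent : ∀ j → j ≤ l → suc m ℕ.* j ℕ.+ 1 ℕ.* (l ∸ j) ≡ m ℕ.* j ℕ.+ l
    exponent j j≤l =
      trans (solve 3 (λ m j d → (con 1 :+ m) :* j :+ con 1 :* d := m :* j :+ (j :+ d)) refl m j (l ∸ j))
            (cong (m ℕ.* j ℕ.+_) (ℕP.m+[n∸m]≡n j≤l))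
      where open ℕS
    sign : ∀ j → sgn (suc m) ^ℚ j ≡ sgn (j ℕ.* (m ℕ.+ 1))
    sign j = trans (sym (sgn-* (suc m) j))
                   (cong sgn (trans (ℕP.*-comm (suc m) j) (cong (j ℕ.*_) (ℕP.+-comm 1 m))))
    term : ∀ j → j ≤ l → binomialTerm F (expN 1) l j t
                         ≡ cexp (ℕ→ℚ (l C j) * sgn (j ℕ.* (m ℕ.+ 1))) (m ℕ.* j ℕ.+ l) t
    term j j≤l = begin
      ℕ→ℚ (l C j) * ((F ^S j) ⊛ (expN 1 ^S (l ∸ j))) t
        ≡⟨ cong (ℕ→ℚ (l C j) *_) (⊛-cong (cexp-^S (sgn (suc m)) (suc m) j) (expN-^S 1 (l ∸ j)) t) ⟩
      ℕ→ℚ (l C j) * (cexp (sgn (suc m) ^ℚ j) (suc m ℕ.* j) ⊛ expN (1 ℕ.* (l ∸ j))) t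
        ≡⟨ cong (ℕ→ℚ (l C j) *_)
                (trans (scale-⊛ˡ (sgn (suc m) ^ℚ j) (expN (suc m ℕ.* j)) (expN (1 ℕ.* (l ∸ j))) t)
                       (cong (sgn (suc m) ^ℚ j *_) (expN-⊛ (suc m ℕ.* j) (1 ℕ.* (l ∸ j)) t))) ⟩
      ℕ→ℚ (l C j) * (sgn (suc m) ^ℚ j * expN (suc m ℕ.* j ℕ.+ 1 ℕ.* (l ∸ j)) t)
        ≡⟨ cong₂ (λ s x → ℕ→ℚ (l C j) * (s * expN x t)) (sign j) (exponent j j≤l) ⟩
      ℕ→ℚ (l C j) * (sgn (j ℕ.* (m ℕ.+ 1)) * expN (m ℕ.* j ℕ.+ l) t)
        ≡⟨ sym (*-assoc (ℕ→ℚ (l C j)) _ _) ⟩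
      cexp (ℕ→ℚ (l C j) * sgn (j ℕ.* (m ℕ.+ 1))) (m ℕ.* j ℕ.+ l) t ∎

  recipExpPlusOne : PS
  recipExpPlusOne = invS expPlusOne

  -- e^z + (-1)^{m+1} e^{(m+1)z} = -(e^z + 1) Σ_{i=1}^{m} (-1)^i e^{iz}, so dividing by e^z + 1 leaves -R.
  recip-⊛-expPair : ∀ m → (recipExpPlusOne ⊛ expPair m) ≗ scaleS (sgn 1) (altExpSum 1 m)
  recip-⊛-expPair m t = begin
    (I ⊛ expPair m) t                         ≡⟨ ⊛-congʳ I expPair-as-product t ⟩
    (I ⊛ scaleS (sgn 1) (expPlusOne ⊛ R)) t   ≡⟨ scale-⊛ʳ (sgn 1) I (expPlusOne ⊛ R) t ⟩
    sgn 1 * (I ⊛ (expPlusOne ⊛ R)) t          ≡⟨ cong (sgn 1 *_) (sym (⊛-assoc I expPlusOne R t)) ⟩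
    sgn 1 * ((I ⊛ expPlusOne) ⊛ R) t          ≡⟨ cong (sgn 1 *_) (⊛-congˡ R (λ s →
                                                   trans (⊛-comm I expPlusOne s) (⊛-invS expPlusOne s)) t) ⟩
    sgn 1 * (oneS ⊛ R) t                      ≡⟨ cong (sgn 1 *_) (oneS-⊛ R t) ⟩
    sgn 1 * R t                               ∎
    where
    I = recipExpPlusOne
    R = altExpSum 1 m
    expPair-as-product : expPair m ≗ scaleS (sgn 1) (expPlusOne ⊛ R)
    expPair-as-product t = begin
      s * y + x
        ≡⟨ solve 3 (λ s x y → s :* y :+ x := (:- con 1ℚ) :* ((:- con 1ℚ) :* x :+ (:- s) :* y)) refl s x y ⟩
      - 1ℚ * (- 1ℚ * x + - s * y)
        ≡⟨ cong₂ (λ u v → u * (u * x + v * y)) (sym (sgn-suc 0)) (sym (sgn-suc (suc m))) ⟩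
      sgn 1 * ((signedExp 1 ⊕ cexp (sgn (suc (suc m))) (suc m)) t)
        ≡⟨ cong (sgn 1 *_) (sym (telescope 1 m t)) ⟩
      sgn 1 * (expPlusOne ⊛ R) t ∎
      where
      open QS
      s = sgn (suc m)
      x = expN 1 t
      y = expN (suc m) t

  genocchiKernel : PS
  genocchiKernel = scaleS (ℕ→ℚ 2) (zS recipExpPlusOne)

  egf-product : ∀ (u v : PS) N →
    sumTo N (λ k → ℕ→ℚ (N C k) * (ℕ→ℚ (k !) * u k) * (ℕ→ℚ ((N ∸ k) !) * v (N ∸ k)))
      ≡ ℕ→ℚ (N !) * (u ⊛ v) N
  egf-product u v N = begin
    sumTo N (λ k → ℕ→ℚ (N C k) * (ℕ→ℚ (k !) * u k) * (ℕ→ℚ ((N ∸ k) !) * v (N ∸ k)))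
      ≡⟨ sumTo-cong≤ N (λ k k≤N → trans
           (solve 5 (λ c a b p q → c :* (a :* p) :* (b :* q) := c :* (a :* b) :* (p :* q)) refl
                  (ℕ→ℚ (N C k)) (ℕ→ℚ (k !)) (ℕ→ℚ ((N ∸ k) !)) (u k) (v (N ∸ k)))
           (cong (_* (u k * v (N ∸ k))) (N!≡ k≤N))) ⟩
    sumTo N (λ k → ℕ→ℚ (N !) * (u k * v (N ∸ k)))
      ≡⟨ sym (sumTo-*ˡ N (ℕ→ℚ (N !)) _) ⟩
    ℕ→ℚ (N !) * (u ⊛ v) N ∎
    where
    open QS
    N!≡ : ∀ {k} → k ≤ N → ℕ→ℚ (N C k) * (ℕ→ℚ (k !) * ℕ→ℚ ((N ∸ k) !)) ≡ ℕ→ℚ (N !)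
    N!≡ {k} k≤N = trans (cong (ℕ→ℚ (N C k) *_) (sym (ℕ→ℚ-* (k !) ((N ∸ k) !))))
                        (trans (sym (ℕ→ℚ-* (N C k) _)) (cong ℕ→ℚ (C*k!*[n∸k]! k≤N)))

  genocchi-convolution : ∀ l j x N → j ≤ l →
    sumTo N (λ k → ℕ→ℚ (N C k) * genocchiPoly j x k * genocchiNum (l ∸ j) (N ∸ k))
      ≡ ℕ→ℚ (N !) * ((genocchiKernel ^S l) ⊛ expS x) N
  genocchi-convolution l j x N j≤l = trans (egf-product (genocchiGF j x) (genocchiGF (l ∸ j) 0ℚ) N)
    (cong (ℕ→ℚ (N !) *_)
      (trans (⊛-interchange (K ^S j) (expS x) (K ^S (l ∸ j)) (expS 0ℚ) N)
             (⊛-cong (λ s → trans (sym (^S-+ K j (l ∸ j) s))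
                                  (cong (λ e → (K ^S e) s) (ℕP.m+[n∸m]≡n j≤l)))
                     (λ s → trans (⊛-congʳ (expS x) expS-zero s) (⊛-oneS (expS x) s)) N)))
    where K = genocchiKernel

  -- The factor z^l of kernel^l shifts coefficients:
  --   [z^{n+l}] kernel^l P = 2^l [z^n] (1/(e^z+1))^l P.
  genocchiKernel-^S-coeff : ∀ l n P →
    ((genocchiKernel ^S l) ⊛ P) (n ℕ.+ l) ≡ ℕ→ℚ 2 ^ℚ l * ((recipExpPlusOne ^S l) ⊛ P) n
  genocchiKernel-^S-coeff l n P = begin
    ((genocchiKernel ^S l) ⊛ P) (n ℕ.+ l)
      ≡⟨ ⊛-congˡ P (λ s → trans (scale-^S (ℕ→ℚ 2) (zS I) l s) (cong (ℕ→ℚ 2 ^ℚ l *_) (zS-^S I l s)))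
                   (n ℕ.+ l) ⟩
    (scaleS (ℕ→ℚ 2 ^ℚ l) (zSⁿ l (I ^S l)) ⊛ P) (n ℕ.+ l)
      ≡⟨ scale-⊛ˡ (ℕ→ℚ 2 ^ℚ l) (zSⁿ l (I ^S l)) P (n ℕ.+ l) ⟩
    ℕ→ℚ 2 ^ℚ l * (zSⁿ l (I ^S l) ⊛ P) (n ℕ.+ l)
      ≡⟨ cong (ℕ→ℚ 2 ^ℚ l *_) (trans (zSⁿ-⊛ l (I ^S l) P (n ℕ.+ l))
                                     (trans (cong (zSⁿ l ((I ^S l) ⊛ P)) (ℕP.+-comm n l))
                                            (zSⁿ-coeff l ((I ^S l) ⊛ P) n))) ⟩
    ℕ→ℚ 2 ^ℚ l * ((I ^S l) ⊛ P) n ∎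
    where I = recipExpPlusOne

  genocchi-sum : ∀ m n l →
    sumTo l (λ j → ℕ→ℚ (l C j) * sgn (j ℕ.* (m ℕ.+ 1)) * invRisingSuc n l
      * sumTo (n ℕ.+ l) (λ k → ℕ→ℚ ((n ℕ.+ l) C k) * genocchiPoly j (ℕ→ℚ (m ℕ.* j ℕ.+ l)) k
                                 * genocchiNum (l ∸ j) (n ℕ.+ l ∸ k)))
      ≡ invRisingSuc n l * (ℕ→ℚ ((n ℕ.+ l) !) * ((genocchiKernel ^S l) ⊛ (expPair m ^S l)) (n ℕ.+ l))
  genocchi-sum m n l = begin
    sumTo l (λ j → c j * iR * sumTo N (λ k → ℕ→ℚ (N C k) * genocchiPoly j (ℕ→ℚ (x j)) k
                                                         * genocchiNum (l ∸ j) (N ∸ k)))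
      ≡⟨ sumTo-cong≤ l (λ j j≤l →
           cong (c j * iR *_) (genocchi-convolution l j (ℕ→ℚ (x j)) N j≤l)) ⟩
    sumTo l (λ j → c j * iR * (N! * coeff j))
      ≡⟨ sumTo-cong l (λ j → solve 4 (λ c i f q → c :* i :* (f :* q) := (i :* f) :* (c :* q)) refl
                                    (c j) iR N! (coeff j)) ⟩
    sumTo l (λ j → (iR * N!) * (c j * coeff j))
      ≡⟨ sym (sumTo-*ˡ l (iR * N!) (λ j → c j * coeff j)) ⟩
    (iR * N!) * sumTo l (λ j → c j * coeff j)
      ≡⟨ cong ((iR * N!) *_) (sym (begin
           ((K ^S l) ⊛ (expPair m ^S l)) N
             ≡⟨ ⊛-congʳ (K ^S l) (expPair-^S m l) N ⟩
           ((K ^S l) ⊛ ΣS l (λ j → cexp (c j) (x j))) N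
             ≡⟨ ⊛-ΣS l (λ j → cexp (c j) (x j)) (K ^S l) N ⟩
           sumTo l (λ j → ((K ^S l) ⊛ cexp (c j) (x j)) N)
             ≡⟨ sumTo-cong l (λ j → scale-⊛ʳ (c j) (K ^S l) (expN (x j)) N) ⟩
           sumTo l (λ j → c j * coeff j) ∎)) ⟩
    (iR * N!) * ((K ^S l) ⊛ (expPair m ^S l)) N
      ≡⟨ *-assoc iR N! _ ⟩
    iR * (N! * ((K ^S l) ⊛ (expPair m ^S l)) N) ∎
    where
    open QS
    K  = genocchiKernel
    N  = n ℕ.+ l
    N! = ℕ→ℚ (N !)
    iR = invRisingSuc n l
    c : ℕ → ℚ
    c j = ℕ→ℚ (l C j) * sgn (j ℕ.* (m ℕ.+ 1))
    x : ℕ → ℕ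
    x j = m ℕ.* j ℕ.+ l
    coeff : ℕ → ℚ
    coeff j = ((K ^S l) ⊛ expN (x j)) N

  -- kernel^l (expPair m)^l = (2z)^l ((e^z + 1)^{-1} expPair m)^l = (-2z)^l R^l.
  genocchiKernel-expPair : ∀ m n l →
    ((genocchiKernel ^S l) ⊛ (expPair m ^S l)) (n ℕ.+ l) ≡ ℕ→ℚ 2 ^ℚ l * (sgn l * (altExpSum 1 m ^S l) n)
  genocchiKernel-expPair m n l =
    trans (genocchiKernel-^S-coeff l n (expPair m ^S l)) (cong (ℕ→ℚ 2 ^ℚ l *_) (begin
    ((I ^S l) ⊛ (expPair m ^S l)) n       ≡⟨ sym (⊛-^S I (expPair m) l n) ⟩
    ((I ⊛ expPair m) ^S l) n              ≡⟨ ^S-cong l (recip-⊛-expPair m) n ⟩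
    (scaleS (sgn 1) R ^S l) n             ≡⟨ scale-^S (sgn 1) R l n ⟩
    sgn 1 ^ℚ l * (R ^S l) n               ≡⟨ cong (_* (R ^S l) n)
                                                   (trans (sym (sgn-* 1 l)) (cong sgn (ℕP.*-identityˡ l))) ⟩
    sgn l * (R ^S l) n                    ∎))
    where
    I = recipExpPlusOne
    R = altExpSum 1 m

  normalisation : ∀ n l y →
    invPow2 l * (invRisingSuc n l * (ℕ→ℚ ((n ℕ.+ l) !) * (ℕ→ℚ 2 ^ℚ l * y))) ≡ ℕ→ℚ (n !) * y
  normalisation n l y = begin
    invPow2 l * (iR * (ℕ→ℚ ((n ℕ.+ l) !) * (ℕ→ℚ 2 ^ℚ l * y)))
      ≡⟨ cong₂ (λ a b → invPow2 l * (iR * (a * (b * y))))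
               (trans (cong ℕ→ℚ (sym (rising*! n l))) (ℕ→ℚ-* (rising (suc n) l) (n !)))
               (sym (ℕ→ℚ-^ 2 l)) ⟩
    invPow2 l * (iR * (ℕ→ℚ (rising (suc n) l) * ℕ→ℚ (n !) * (ℕ→ℚ (2 ℕ.^ l) * y)))
      ≡⟨ solve 6 (λ p i r f t y → p :* (i :* (r :* f :* (t :* y))) := (p :* t) :* (i :* r) :* (f :* y)) refl
               (invPow2 l) iR (ℕ→ℚ (rising (suc n) l)) (ℕ→ℚ (n !)) (ℕ→ℚ (2 ℕ.^ l)) y ⟩
    (invPow2 l * ℕ→ℚ (2 ℕ.^ l)) * (iR * ℕ→ℚ (rising (suc n) l)) * (ℕ→ℚ (n !) * y)
      ≡⟨ cong₂ (λ a b → a * b * (ℕ→ℚ (n !) * y))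
               ([i/d]*d≡i (ℤ.+ 1) (2 ℕ.^ l) {{m^n≢0 2 l}})
               ([i/d]*d≡i (ℤ.+ 1) (rising (suc n) l) {{rising≢0 n l}}) ⟩
    1ℚ * 1ℚ * (ℕ→ℚ (n !) * y)
      ≡⟨ *-identityˡ _ ⟩
    ℕ→ℚ (n !) * y ∎
    where
    open QS
    iR = invRisingSuc n l

open import Data.Nat using (ℕ; _+_; _*_; _∸_; _!)
open import Data.Nat.Combinatorics using (_C_)
open import Data.Rational using (ℚ) renaming (_*_ to _*ℚ_)
open import Relation.Binary.PropositionalEquality using (_≡_; cong; sym; module ≡-Reasoning)
open ≡-Reasoning
open Proof

-- Both sides equal  n! (-1)^l [z^n] R^l;  the right side is brought to that
-- form by undoing the normalising constants and the two series computations.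

corollary2p8 : (m n l : ℕ) →
    ℤ→ℚ (Z n l m)
      ≡ invPow2 l *ℚ sumTo l (λ j →
          ℕ→ℚ (l C j) *ℚ ℤ→ℚ (signℤ (j * (m + 1))) *ℚ invRisingSuc n l
            *ℚ sumTo (n + l) (λ k →
                 ℕ→ℚ ((n + l) C k)
                   *ℚ genocchiPoly j (ℕ→ℚ (m * j + l)) k
                   *ℚ genocchiNum (l ∸ j) (n + l ∸ k)))
corollary2p8 m n l = begin
    ℤ→ℚ (Z n l m)
  ≡⟨ Z-as-coefficient n l m ⟩
    ℕ→ℚ (n !) *ℚ (sgn l *ℚ Y)
  ≡⟨ sym (normalisation n l (sgn l *ℚ Y)) ⟩
    invPow2 l *ℚ (invRisingSuc n l *ℚ (ℕ→ℚ ((n + l) !) *ℚ (ℕ→ℚ 2 ^ℚ l *ℚ (sgn l *ℚ Y))))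
  ≡⟨ cong (λ y → invPow2 l *ℚ (invRisingSuc n l *ℚ (ℕ→ℚ ((n + l) !) *ℚ y)))
          (sym (genocchiKernel-expPair m n l)) ⟩
    invPow2 l *ℚ (invRisingSuc n l *ℚ (ℕ→ℚ ((n + l) !)
                   *ℚ ((genocchiKernel ^S l) ⊛ (expPair m ^S l)) (n + l)))
  ≡⟨ cong (invPow2 l *ℚ_) (sym (genocchi-sum m n l)) ⟩
    invPow2 l *ℚ sumTo l (λ j →
          ℕ→ℚ (l C j) *ℚ ℤ→ℚ (signℤ (j * (m + 1))) *ℚ invRisingSuc n l
            *ℚ sumTo (n + l) (λ k →
                 ℕ→ℚ ((n + l) C k)
                   *ℚ genocchiPoly j (ℕ→ℚ (m * j + l)) k
                   *ℚ genocchiNum (l ∸ j) (n + l ∸ k))) ∎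
  where Y = (altExpSum 1 m ^S l) n
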